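{- Let $n\ge 2$, $1\le k\le n-1$, and let $G$ be a connected simple graph of order $n$ with edge connectivity $k$ that has no trivial $k$-edge cut. Then there is an integer $m$ with $\max\{k,2\}\le m\le\lfloor n/2\rfloor$ such that $G\preceq K^k_{n-m,m}$.
   Context: For $S\subsetneq V(G)$ nonempty, the edge cut $\partial(S)$ is the set of edges with exactly one end in $S$; it is a $k$-edge cut if it has exactly $k$ edges, and trivial if $|S|=1$. $m(G,t)$ is the number of $t$-matchings of $G$, $m(G,0)=1$. For graphs $G_1,G_2$ of order $n$, $G_1\preceq G_2$ means $m(G_1,t)\le m(G_2,t)$ for all $t=0,\dots,\lfloor n/2\rfloor$. For $k\le m\le\lfloor n/2\rfloor$, $K^k_{n-m,m}$ is the graph obtained from the disjoint union $K_{n-m}\cup K_m$ by adding $k$ pairwise vertex-disjoint edges each joining a vertex of $K_{n-m}$ to a vertex of $K_m$. -}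

module Defs where

open import Data.Nat using (ℕ; zero; suc; _+_; _≤_; _<ᵇ_; _≡ᵇ_; _/_; _⊔_)
open import Data.Bool using (Bool; true; false; _∧_; _∨_; not; _xor_; if_then_else_; T)
open import Data.Fin using (Fin; toℕ)
open import Data.Fin.Properties using () renaming (_≟_ to _≟F_)
open import Data.List using (List; []; _∷_; concatMap; length; map; allFin)
open import Data.Nat.ListAction using (sum)
open import Data.Bool.ListAction using (all)
open import Data.Vec using (Vec; lookup)
open import Data.Product using (_×_; _,_; ∃-syntax)
open import Relation.Nullary using (¬_)
open import Relation.Nullary.Decidable using (isYes)
open import Relation.Binary.PropositionalEquality using (_≡_)

Adj : ℕ → Set
Adj n = Fin n → Fin n → Bool

record SimpleGraph (n : ℕ) : Set where
  field
    adj   : Adj n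
    sym   : ∀ i j → adj i j ≡ adj j i
    loopless : ∀ i → adj i i ≡ false
open SimpleGraph public

data Reach {n : ℕ} (a : Adj n) : Fin n → Fin n → Set where
  here : ∀ {i} → Reach a i i
  step : ∀ {i j l} → T (a i j) → Reach a j l → Reach a i l

Connected : ∀ {n} → SimpleGraph n → Set
Connected G = ∀ i j → Reach (adj G) i j

_==F_ : ∀ {n} → Fin n → Fin n → Bool
i ==F j = isYes (i ≟F j)

edges : ∀ {n} → Adj n → List (Fin n × Fin n)
edges {n} a = concatMap (λ i → concatMap (λ j →
  if (toℕ i <ᵇ toℕ j) ∧ a i j then (i , j) ∷ [] else []) (allFin n)) (allFin n)

countBy : ∀ {A : Set} → (A → Bool) → List A → ℕ
countBy p xs = sum (map (λ x → if p x then 1 else 0) xs)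

Subset : ℕ → Set
Subset n = Vec Bool n

NonemptyProper : ∀ {n} → Subset n → Set
NonemptyProper {n} S = (∃[ x ] lookup S x ≡ true) × (∃[ y ] lookup S y ≡ false)

cutSize : ∀ {n} → SimpleGraph n → Subset n → ℕ
cutSize G S = countBy (λ { (i , j) → lookup S i xor lookup S j }) (edges (adj G))

EdgeConnectivity : ∀ {n} → SimpleGraph n → ℕ → Set
EdgeConnectivity {n} G k =
  (∀ (S : Subset n) → NonemptyProper S → k ≤ cutSize G S) ×
  (∃[ S ] (NonemptyProper S × cutSize G S ≡ k))

-- The trivial cut ∂({v}) has size deg v; "no trivial k-edge cut".
singleton : ∀ {n} → Fin n → Subset n
singleton {n} v = Data.Vec.tabulate (λ x → x ==F v)

NoTrivialCut : ∀ {n} → SimpleGraph n → ℕ → Set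
NoTrivialCut G k = ∀ v → ¬ (cutSize G (singleton v) ≡ k)

sublists : ∀ {A : Set} → List A → List (List A)
sublists [] = [] ∷ []
sublists (x ∷ xs) = let r = sublists xs in map (x ∷_) r Data.List.++ r

disjointE : ∀ {n} → Fin n × Fin n → Fin n × Fin n → Bool
disjointE (a , b) (c , d) = not ((a ==F c) ∨ (a ==F d) ∨ (b ==F c) ∨ (b ==F d))

isMatching : ∀ {n} → List (Fin n × Fin n) → Bool
isMatching [] = true
isMatching (e ∷ es) = all (disjointE e) es ∧ isMatching es

-- m(G,t): number of t-matchings (works for any adjacency; only pairs i<j used).
matchCount : ∀ {n} → Adj n → ℕ → ℕ
matchCount a t = countBy (λ M → (length M ≡ᵇ t) ∧ isMatching M) (sublists (edges a))

_⪯_ : ∀ {n} → Adj n → Adj n → Set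
_⪯_ {n} a b = ∀ t → t ≤ n / 2 → matchCount a t ≤ matchCount b t

-- K^k_{n-m,m} on Fin n: vertices with index < m form K_m, the rest K_{n-m};
-- extra edges {i , m+i} for i < k (pairwise disjoint, when k ≤ m ≤ n-m).
sameSide : ℕ → ℕ → ℕ → Bool
sameSide m i j = (i <ᵇ m) ∧ (j <ᵇ m) ∨ not (i <ᵇ m) ∧ not (j <ᵇ m)

cross : ℕ → ℕ → ℕ → ℕ → Bool
cross m k i j = (i <ᵇ k) ∧ (j ≡ᵇ (m + i))

Kkm : (n m k : ℕ) → Adj n
Kkm n m k x y = (sameSide m (toℕ x) (toℕ y) ∧ not (x ==F y))
              ∨ cross m k (toℕ x) (toℕ y) ∨ cross m k (toℕ y) (toℕ x)

module Submission where

-- Fix a k-edge cut ∂(S).  Since no vertex has degree k, every degree is ≥ k+1,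
-- and a degree count shows that both S and its complement have more than k vertices
-- ('DegreeCount.side-exceeds').  Let m be the size of the smaller side, so k < m ≤ n/2.
-- Then m(G,t) ≤ m(K^k_{n-m,m},t) by an explicit injection on t-matchings
-- ('MatchingInjection'): a matching M is relabelled by a vertex permutation σ_M that
-- sends the chosen side onto the clique K_m and each crossing edge c_j ∈ M onto the
-- cross edge {j , m+j}; its image is a t-matching of K^k_{n-m,m} from which M can be
-- read back.

open import Data.Nat using (ℕ; zero; suc; _+_; _*_; _∸_; _≤_; _<_; z≤n; s≤s; _<ᵇ_; _≡ᵇ_; _<?_; _≤?_; _/_; _⊔_)
open import Data.Nat.Properties
open import Data.Nat.DivMod using (m*n/n≡m; /-monoˡ-≤)
open import Data.Bool using (Bool; true; false; _∧_; _∨_; not; _xor_; if_then_else_; T)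
open import Data.Bool.Properties using (∨-zeroʳ; not-involutive)
open import Data.Bool.ListAction using (all)
open import Data.Fin using (Fin; toℕ; fromℕ<)
open import Data.Fin.Properties using (toℕ-injective; toℕ-fromℕ<) renaming (_≟_ to _≟F_)
open import Data.List using (List; []; _∷_; map; length; concatMap; allFin)
open import Data.List.Properties using (length-map; length-++; length-tabulate) renaming (≡-dec to ≡-decL)
open import Data.List.Membership.Propositional using (_∈_; _∉_; find; lose)
open import Data.List.Membership.Propositional.Properties
  using (∈-++⁻; ∈-++⁺ˡ; ∈-++⁺ʳ; map∷⁻; ∈-map⁺; ∈-map⁻; ∈-concatMap⁺; ∈-concatMap⁻; ∈-allFin; ∈-AllPairs₂)
import Data.List.Membership.DecPropositional as DecMembership
open import Data.List.Relation.Unary.Any using (here; there)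
open import Data.List.Relation.Unary.All using (All; []; _∷_)
import Data.List.Relation.Unary.All as All
open import Data.List.Relation.Unary.All.Properties using (¬Any⇒All¬)
open import Data.List.Relation.Unary.AllPairs using (AllPairs; []; _∷_)
open import Data.List.Relation.Unary.Unique.Propositional using (Unique)
open import Data.List.Relation.Unary.Unique.Propositional.Properties using (++⁺; allFin⁺; Unique[x∷xs]⇒x∉xs)
open import Data.Vec using (lookup)
import Data.Vec as Vec
open import Data.Vec.Properties using (lookup∘tabulate; lookup-map)
open import Data.Product using (_×_; _,_; proj₁; proj₂; ∃-syntax)
open import Data.Product.Properties using () renaming (≡-dec to ≡-dec×)
open import Data.Sum using (_⊎_; inj₁; inj₂)
open import Data.Empty using (⊥-elim)
open import Relation.Nullary using (¬_; Dec; yes; no)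
open import Relation.Nullary.Decidable using (isYes)
open import Relation.Binary.Definitions using (DecidableEquality; tri<; tri≈; tri>)
open import Relation.Binary.PropositionalEquality
open import Function using (_∘_)
open import Defs hiding (sym)

-- Boolean filter matching the 'if … then … else' shape of 'countBy'.
filterB : ∀ {A : Set} → (A → Bool) → List A → List A
filterB p [] = []
filterB p (x ∷ xs) = if p x then x ∷ filterB p xs else filterB p xs

true≢false : true ≢ false
true≢false ()

tail-unique : ∀ {A : Set} {x : A} {xs} → Unique (x ∷ xs) → Unique xs
tail-unique (_ ∷ u) = u

∉-unique : ∀ {A : Set} {x : A} {xs} → x ∉ xs → Unique xs → Unique (x ∷ xs)
∉-unique x∉ u = ¬Any⇒All¬ _ x∉ ∷ u

module _ {A : Set} where

  countBy-length : (p : A → Bool) (xs : List A) → countBy p xs ≡ length (filterB p xs)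
  countBy-length p [] = refl
  countBy-length p (x ∷ xs) with p x
  ... | true = cong suc (countBy-length p xs)
  ... | false = countBy-length p xs

  filterB-∈ : ∀ (p : A → Bool) {x} xs → x ∈ filterB p xs → x ∈ xs × p x ≡ true
  filterB-∈ p (y ∷ xs) h with p y in eq
  filterB-∈ p (y ∷ xs) (here refl) | true = here refl , eq
  filterB-∈ p (y ∷ xs) (there h) | true = let a , b = filterB-∈ p xs h in there a , b
  ... | false = let a , b = filterB-∈ p xs h in there a , b

  ∈-filterB : ∀ (p : A → Bool) {x} xs → x ∈ xs → p x ≡ true → x ∈ filterB p xs
  ∈-filterB p (y ∷ xs) (here refl) px rewrite px = here refl
  ∈-filterB p (y ∷ xs) (there h) px with p y
  ... | true = there (∈-filterB p xs h px)
  ... | false = ∈-filterB p xs h px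

  filterB-unique : ∀ (p : A → Bool) {xs} → Unique xs → Unique (filterB p xs)
  filterB-unique p [] = []
  filterB-unique p {y ∷ xs} (y∉ ∷ u) with p y
  ... | true = ∉-unique (λ h → Unique[x∷xs]⇒x∉xs (y∉ ∷ u) (proj₁ (filterB-∈ p xs h))) (filterB-unique p u)
  ... | false = filterB-unique p u

  map-unique : ∀ {B : Set} (f : A → B) {xs} → Unique xs →
    (∀ {x y} → x ∈ xs → y ∈ xs → f x ≡ f y → x ≡ y) → Unique (map f xs)
  map-unique f [] inj = []
  map-unique f {x ∷ xs} u inj =
    ∉-unique fx∉ (map-unique f (tail-unique u) (λ a b e → inj (there a) (there b) e))
    where
    fx∉ : f x ∉ map f xs
    fx∉ h = let y , y∈ , fx≡fy = ∈-map⁻ f h in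
      Unique[x∷xs]⇒x∉xs u (subst (_∈ xs) (sym (inj (here refl) (there y∈) fx≡fy)) y∈)

  concatMap-unique : ∀ {B : Set} (f : A → List B) {xs} → Unique xs → (∀ x → Unique (f x)) →
    (∀ {x y z} → x ∈ xs → y ∈ xs → z ∈ f x → z ∈ f y → x ≡ y) → Unique (concatMap f xs)
  concatMap-unique f {[]} _ _ _ = []
  concatMap-unique f {x ∷ xs} u uf dis =
    ++⁺ (uf x) (concatMap-unique f (tail-unique u) uf (λ x∈ y∈ → dis (there x∈) (there y∈))) apart
    where
    apart : ∀ {v} → ¬ (v ∈ f x × v ∈ concatMap f xs)
    apart (h1 , h2) with find (∈-concatMap⁻ f h2)
    ... | y , y∈ , h3 = Unique[x∷xs]⇒x∉xs u (subst (_∈ xs) (sym (dis (here refl) (there y∈) h1 h3)) y∈)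

module _ {A : Set} (_≟_ : DecidableEquality A) where

  private
    remove : A → List A → List A
    remove x [] = []
    remove x (y ∷ ys) with x ≟ y
    ... | yes _ = ys
    ... | no _ = y ∷ remove x ys

    remove-length : ∀ {x} ys → x ∈ ys → length ys ≡ suc (length (remove x ys))
    remove-length {x} (y ∷ ys) h with x ≟ y
    ... | yes _ = refl
    remove-length {x} (y ∷ ys) (here e) | no ne = ⊥-elim (ne e)
    remove-length {x} (y ∷ ys) (there h) | no ne = cong suc (remove-length ys h)

    ∈-remove : ∀ {x z} ys → z ∈ ys → z ≢ x → z ∈ remove x ys
    ∈-remove {x} (y ∷ ys) h ne with x ≟ y
    ∈-remove {x} (y ∷ ys) (here refl) ne | yes refl = ⊥-elim (ne refl)
    ∈-remove {x} (y ∷ ys) (there h) ne | yes refl = h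
    ∈-remove {x} (y ∷ ys) (here e) ne | no _ = here e
    ∈-remove {x} (y ∷ ys) (there h) ne | no _ = there (∈-remove ys h ne)

  unique-length-≤ : ∀ {xs ys} → Unique xs → (∀ {z} → z ∈ xs → z ∈ ys) → length xs ≤ length ys
  unique-length-≤ {[]} _ _ = z≤n
  unique-length-≤ {x ∷ xs} {ys} u sub =
    subst (suc (length xs) ≤_) (sym (remove-length ys (sub (here refl))))
      (s≤s (unique-length-≤ (tail-unique u)
        (λ h → ∈-remove ys (sub (there h)) (λ e → Unique[x∷xs]⇒x∉xs u (subst (_∈ xs) e h)))))

module _ {A : Set} where

  countBy-split : (p q : A → Bool) (xs : List A) →
    countBy p xs ≡ countBy (λ x → p x ∧ q x) xs + countBy (λ x → p x ∧ not (q x)) xs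
  countBy-split p q [] = refl
  countBy-split p q (x ∷ xs) with p x | q x
  ... | true | true = cong suc (countBy-split p q xs)
  ... | true | false = trans (cong suc (countBy-split p q xs)) (sym (+-suc _ _))
  ... | false | _ = countBy-split p q xs

  countBy-cong : (p q : A → Bool) (xs : List A) → (∀ {x} → x ∈ xs → p x ≡ q x) →
    countBy p xs ≡ countBy q xs
  countBy-cong p q [] h = refl
  countBy-cong p q (x ∷ xs) h rewrite h (here refl) =
    cong ((if q x then 1 else 0) +_) (countBy-cong p q xs (λ z → h (there z)))

  countBy-mono : (p q : A → Bool) (xs : List A) → (∀ {x} → x ∈ xs → p x ≡ true → q x ≡ true) →
    countBy p xs ≤ countBy q xs
  countBy-mono p q [] h = z≤n
  countBy-mono p q (x ∷ xs) h with p x in px | q x in qx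
  ... | true | true = s≤s (countBy-mono p q xs (λ z → h (there z)))
  ... | true | false = ⊥-elim (true≢false (trans (sym (h (here refl) px)) qx))
  ... | false | true = m≤n⇒m≤1+n (countBy-mono p q xs (λ z → h (there z)))
  ... | false | false = countBy-mono p q xs (λ z → h (there z))

  countBy-strict : (p q : A → Bool) (xs : List A) → (∀ {x} → x ∈ xs → p x ≡ true → q x ≡ true) →
    ∀ {y} → y ∈ xs → p y ≡ false → q y ≡ true → countBy p xs < countBy q xs
  countBy-strict p q (x ∷ xs) h (here refl) py qy rewrite py | qy =
    s≤s (countBy-mono p q xs (λ z → h (there z)))
  countBy-strict p q (x ∷ xs) h (there y∈) py qy with p x in px | q x in qx
  ... | true | true = s≤s (countBy-strict p q xs (λ z → h (there z)) y∈ py qy)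
  ... | true | false = ⊥-elim (true≢false (trans (sym (h (here refl) px)) qx))
  ... | false | true = m≤n⇒m≤1+n (countBy-strict p q xs (λ z → h (there z)) y∈ py qy)
  ... | false | false = countBy-strict p q xs (λ z → h (there z)) y∈ py qy

  countBy-true : (xs : List A) → countBy (λ _ → true) xs ≡ length xs
  countBy-true [] = refl
  countBy-true (x ∷ xs) = cong suc (countBy-true xs)

  countBy-positive : (p : A → Bool) {xs : List A} {y : A} → y ∈ xs → p y ≡ true → 1 ≤ countBy p xs
  countBy-positive p {xs} y∈ py =
    subst (_< countBy p xs) (countBy-false xs) (countBy-strict (λ _ → false) p xs (λ _ ()) y∈ refl py)
    where
    countBy-false : (zs : List A) → countBy (λ _ → false) zs ≡ 0
    countBy-false [] = refl
    countBy-false (z ∷ zs) = countBy-false zs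

count-injection : ∀ {A B : Set} → DecidableEquality B → (p : A → Bool) (q : B → Bool)
  (xs : List A) (ys : List B) (f : A → B) → Unique xs →
  (∀ {x} → x ∈ xs → p x ≡ true → f x ∈ ys × q (f x) ≡ true) →
  (∀ {x y} → x ∈ xs → y ∈ xs → p x ≡ true → p y ≡ true → f x ≡ f y → x ≡ y) →
  countBy p xs ≤ countBy q ys
count-injection _≟_ p q xs ys f u img inj =
  subst₂ _≤_ (trans (length-map f (filterB p xs)) (sym (countBy-length p xs))) (sym (countBy-length q ys))
    (unique-length-≤ _≟_ (map-unique f (filterB-unique p u) inj′) img′)
  where
  inj′ : ∀ {x y} → x ∈ filterB p xs → y ∈ filterB p xs → f x ≡ f y → x ≡ y
  inj′ x∈ y∈ = let x∈xs , px = filterB-∈ p xs x∈ ; y∈xs , py = filterB-∈ p xs y∈ in inj x∈xs y∈xs px py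
  img′ : ∀ {z} → z ∈ map f (filterB p xs) → z ∈ filterB q ys
  img′ h = let x , x∈ , z≡ = ∈-map⁻ f h ; x∈xs , px = filterB-∈ p xs x∈ ; fx∈ , qfx = img x∈xs px
           in subst (_∈ filterB q ys) (sym z≡) (∈-filterB q ys fx∈ qfx)

length-concatMap-≥ : ∀ {A B : Set} (f : A → List B) (xs : List A) c →
  (∀ {x} → x ∈ xs → c ≤ length (f x)) → length xs * c ≤ length (concatMap f xs)
length-concatMap-≥ f [] c h = z≤n
length-concatMap-≥ f (x ∷ xs) c h =
  subst (c + length xs * c ≤_) (sym (length-++ (f x)))
    (+-mono-≤ (h (here refl)) (length-concatMap-≥ f xs c (λ z → h (there z))))

module _ {A : Set} where

  sublist-⊆ : ∀ {E M : List A} {x} → M ∈ sublists E → x ∈ M → x ∈ E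
  sublist-⊆ {[]} (here refl) ()
  sublist-⊆ {e ∷ E} {M} h xm with ∈-++⁻ (map (e ∷_) (sublists E)) h
  ... | inj₂ h2 = there (sublist-⊆ h2 xm)
  ... | inj₁ h1 with map∷⁻ h1
  ... | M0 , h0 , refl with xm
  ... | here refl = here refl
  ... | there xm0 = there (sublist-⊆ h0 xm0)

  sublists-unique : ∀ {E : List A} → Unique E → Unique (sublists E)
  sublists-unique {[]} _ = [] ∷ []
  sublists-unique {e ∷ E} u =
    ++⁺ (map-unique (e ∷_) (sublists-unique (tail-unique u)) (λ _ _ → ∷-injectiveʳ))
        (sublists-unique (tail-unique u)) apart
    where
    ∷-injectiveʳ : ∀ {a b : List A} → _≡_ {A = List A} (e ∷ a) (e ∷ b) → a ≡ b
    ∷-injectiveʳ refl = refl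
    apart : ∀ {v} → ¬ (v ∈ map (e ∷_) (sublists E) × v ∈ sublists E)
    apart (h1 , h2) with map∷⁻ h1
    ... | M0 , _ , refl = Unique[x∷xs]⇒x∉xs u (sublist-⊆ h2 (here refl))

  sublist-unique : ∀ {E M : List A} → Unique E → M ∈ sublists E → Unique M
  sublist-unique {[]} _ (here refl) = []
  sublist-unique {e ∷ E} u h with ∈-++⁻ (map (e ∷_) (sublists E)) h
  ... | inj₂ h2 = sublist-unique (tail-unique u) h2
  ... | inj₁ h1 with map∷⁻ h1
  ... | M0 , h0 , refl = ∉-unique (λ z → Unique[x∷xs]⇒x∉xs u (sublist-⊆ h0 z)) (sublist-unique (tail-unique u) h0)

  filterB-sublist : ∀ (p : A → Bool) E → filterB p E ∈ sublists E
  filterB-sublist p [] = here refl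
  filterB-sublist p (e ∷ E) with p e
  ... | true = ∈-++⁺ˡ (∈-map⁺ (e ∷_) (filterB-sublist p E))
  ... | false = ∈-++⁺ʳ (map (e ∷_) (sublists E)) (filterB-sublist p E)

  sublist-ext : ∀ {E M M' : List A} → Unique E → M ∈ sublists E → M' ∈ sublists E →
    (∀ {x} → x ∈ M → x ∈ M') → (∀ {x} → x ∈ M' → x ∈ M) → M ≡ M'
  sublist-ext {[]} _ (here refl) (here refl) _ _ = refl
  sublist-ext {e ∷ E} u h h' f g
    with ∈-++⁻ (map (e ∷_) (sublists E)) h | ∈-++⁻ (map (e ∷_) (sublists E)) h'
  ... | inj₁ h1 | inj₁ h1' with map∷⁻ h1 | map∷⁻ h1'
  ... | M0 , h0 , refl | M0' , h0' , refl =
    cong (e ∷_) (sublist-ext (tail-unique u) h0 h0' (λ xm → strip (f (there xm)) (sublist-⊆ h0 xm))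
                                                   (λ xm → strip (g (there xm)) (sublist-⊆ h0' xm)))
    where
    strip : ∀ {x} {L : List A} → x ∈ e ∷ L → x ∈ E → x ∈ L
    strip (here refl) x∈E = ⊥-elim (Unique[x∷xs]⇒x∉xs u x∈E)
    strip (there p) _ = p
  sublist-ext {e ∷ E} u _ _ f g | inj₁ h1 | inj₂ h2' with map∷⁻ h1
  ... | M0 , h0 , refl = ⊥-elim (Unique[x∷xs]⇒x∉xs u (sublist-⊆ h2' (f (here refl))))
  sublist-ext {e ∷ E} u _ _ f g | inj₂ h2 | inj₁ h1' with map∷⁻ h1'
  ... | M0 , h0 , refl = ⊥-elim (Unique[x∷xs]⇒x∉xs u (sublist-⊆ h2 (g (here refl))))
  sublist-ext {e ∷ E} u _ _ f g | inj₂ h2 | inj₂ h2' = sublist-ext (tail-unique u) h2 h2' f g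

module _ {n : ℕ} where

  ==F-true : {i j : Fin n} → (i ==F j) ≡ true → i ≡ j
  ==F-true {i} {j} h with i ≟F j
  ... | yes e = e
  ... | no _ = ⊥-elim (true≢false (sym h))

  ==F-refl : (i : Fin n) → (i ==F i) ≡ true
  ==F-refl i with i ≟F i
  ... | yes _ = refl
  ... | no ne = ⊥-elim (ne refl)

  ==F-false : {i j : Fin n} → i ≢ j → (i ==F j) ≡ false
  ==F-false {i} {j} ne with i ≟F j
  ... | yes e = ⊥-elim (ne e)
  ... | no _ = refl

  ==F-false⁻ : {i j : Fin n} → (i ==F j) ≡ false → i ≢ j
  ==F-false⁻ {i} h refl = true≢false (trans (sym (==F-refl i)) h)

T→≡ : ∀ {b} → T b → b ≡ true
T→≡ {true} _ = refl

<ᵇ-true : ∀ {x y} → x < y → (x <ᵇ y) ≡ true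
<ᵇ-true h = T→≡ (<⇒<ᵇ h)

<ᵇ-false : ∀ {x y} → y ≤ x → (x <ᵇ y) ≡ false
<ᵇ-false {x} {y} h with x <ᵇ y in e
... | true = ⊥-elim (<⇒≱ (<ᵇ⇒< x y (subst T (sym e) _)) h)
... | false = refl

<ᵇ-true⁻ : ∀ {x y} → (x <ᵇ y) ≡ true → x < y
<ᵇ-true⁻ {x} {y} h = <ᵇ⇒< x y (subst T (sym h) _)

<ᵇ-false⁻ : ∀ {x y} → (x <ᵇ y) ≡ false → y ≤ x
<ᵇ-false⁻ h = ≮⇒≥ (λ lt → true≢false (trans (sym (<ᵇ-true lt)) h))

∧-split : ∀ {p q : Bool} → (p ∧ q) ≡ true → p ≡ true × q ≡ true
∧-split {true} {true} _ = refl , refl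

not-true⁻ : ∀ {p : Bool} → not p ≡ true → p ≡ false
not-true⁻ {false} _ = refl

xor-false⁻ : ∀ {p q : Bool} → (p xor q) ≡ false → p ≡ q
xor-false⁻ {true} {true} _ = refl
xor-false⁻ {false} {false} _ = refl

Edge : ℕ → Set
Edge n = Fin n × Fin n

module _ {n : ℕ} (a : Adj n) where

  private
    cell : Fin n → Fin n → List (Edge n)
    cell i j = if (toℕ i <ᵇ toℕ j) ∧ a i j then (i , j) ∷ [] else []

    row : Fin n → List (Edge n)
    row i = concatMap (cell i) (allFin n)

    cell-∈ : ∀ {i j e} → e ∈ cell i j → e ≡ (i , j) × T (toℕ i <ᵇ toℕ j) × a i j ≡ true
    cell-∈ {i} {j} h with toℕ i <ᵇ toℕ j | a i j
    cell-∈ (here refl) | true | true = refl , _ , refl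
    cell-∈ () | true | false
    cell-∈ () | false | _

  ∈-edges⁻ : ∀ {i j} → (i , j) ∈ edges a → toℕ i < toℕ j × a i j ≡ true
  ∈-edges⁻ h with find (∈-concatMap⁻ row {xs = allFin n} h)
  ... | i' , _ , h2 with find (∈-concatMap⁻ (cell i') {xs = allFin n} h2)
  ... | j' , _ , h3 with cell-∈ h3
  ... | refl , lt , aij = <ᵇ⇒< _ _ lt , aij

  ∈-edges⁺ : ∀ {i j} → toℕ i < toℕ j → a i j ≡ true → (i , j) ∈ edges a
  ∈-edges⁺ {i} {j} lt aij =
    ∈-concatMap⁺ row (lose (∈-allFin i) (∈-concatMap⁺ (cell i) (lose (∈-allFin j) ij∈)))
    where
    ij∈ : (i , j) ∈ cell i j
    ij∈ rewrite <ᵇ-true lt | aij = here refl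

  edges-unique : Unique (edges a)
  edges-unique = concatMap-unique row (allFin⁺ n) row-unique
    (λ {x} {y} _ _ h1 h2 → let _ , _ , h1' = find (∈-concatMap⁻ (cell x) {xs = allFin n} h1)
                               _ , _ , h2' = find (∈-concatMap⁻ (cell y) {xs = allFin n} h2)
                           in cong proj₁ (trans (sym (proj₁ (cell-∈ h1'))) (proj₁ (cell-∈ h2'))))
    where
    cell-unique : ∀ i j → Unique (cell i j)
    cell-unique i j with (toℕ i <ᵇ toℕ j) ∧ a i j
    ... | true = [] ∷ []
    ... | false = []
    row-unique : ∀ i → Unique (row i)
    row-unique i = concatMap-unique (cell i) (allFin⁺ n) (cell-unique i)
      (λ _ _ h1 h2 → cong proj₂ (trans (sym (proj₁ (cell-∈ h1))) (proj₁ (cell-∈ h2))))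

  edge-endpoints-≢ : ∀ {x y} → (x , y) ∈ edges a → x ≢ y
  edge-endpoints-≢ h refl = <-irrefl refl (proj₁ (∈-edges⁻ h))

module _ {n : ℕ} where

  Disjoint : Edge n → Edge n → Set
  Disjoint (a , b) (c , d) = a ≢ c × a ≢ d × b ≢ c × b ≢ d

  Disjoint-sym : ∀ {e e'} → Disjoint e e' → Disjoint e' e
  Disjoint-sym (p , q , r , s) = (λ x → p (sym x)) , (λ x → r (sym x)) , (λ x → q (sym x)) , (λ x → s (sym x))

  private
    disjointE⁻ : ∀ e e' → disjointE e e' ≡ true → Disjoint e e'
    disjointE⁻ (a , b) (c , d) h with a ==F c in e1 | a ==F d in e2 | b ==F c in e3 | b ==F d in e4
    ... | false | false | false | false = ==F-false⁻ e1 , ==F-false⁻ e2 , ==F-false⁻ e3 , ==F-false⁻ e4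
    ... | true | _ | _ | _ = ⊥-elim (true≢false (sym h))
    ... | false | true | _ | _ = ⊥-elim (true≢false (sym h))
    ... | false | false | true | _ = ⊥-elim (true≢false (sym h))
    ... | false | false | false | true = ⊥-elim (true≢false (sym h))

    disjointE⁺ : ∀ e e' → Disjoint e e' → disjointE e e' ≡ true
    disjointE⁺ (a , b) (c , d) (p , q , r , s)
      rewrite ==F-false p | ==F-false q | ==F-false r | ==F-false s = refl

    all⁻ : ∀ {A : Set} (p : A → Bool) xs → all p xs ≡ true → All (λ x → p x ≡ true) xs
    all⁻ p [] _ = []
    all⁻ p (x ∷ xs) h with p x in e
    ... | true = e ∷ all⁻ p xs h
    ... | false = ⊥-elim (true≢false (sym h))

    all⁺ : ∀ {A : Set} (p : A → Bool) xs → All (λ x → p x ≡ true) xs → all p xs ≡ true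
    all⁺ p [] _ = refl
    all⁺ p (x ∷ xs) (h ∷ hs) rewrite h = all⁺ p xs hs

    matching-AllPairs : ∀ (M : List (Edge n)) → isMatching M ≡ true → AllPairs Disjoint M
    matching-AllPairs [] _ = []
    matching-AllPairs (e ∷ M) h with all (disjointE e) M in q
    ... | true = All.map (λ {e'} → disjointE⁻ e e') (all⁻ (disjointE e) M q) ∷ matching-AllPairs M h
    ... | false = ⊥-elim (true≢false (sym h))

  matching-disjoint : ∀ {M : List (Edge n)} → isMatching M ≡ true →
    ∀ {e e'} → e ∈ M → e' ∈ M → e ≢ e' → Disjoint e e'
  matching-disjoint {M} h e∈ e'∈ ne with ∈-AllPairs₂ (matching-AllPairs M h) e∈ e'∈
  ... | inj₁ eq = ⊥-elim (ne eq)
  ... | inj₂ (inj₁ d) = d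
  ... | inj₂ (inj₂ d) = Disjoint-sym d

  disjoint-matching : ∀ (L : List (Edge n)) → Unique L →
    (∀ {e e'} → e ∈ L → e' ∈ L → e ≢ e' → Disjoint e e') → isMatching L ≡ true
  disjoint-matching [] _ _ = refl
  disjoint-matching (e ∷ L) (u ∷ us) h
    rewrite all⁺ (disjointE e) L
              (All.tabulate (λ {e'} e'∈ → disjointE⁺ e e' (h (here refl) (there e'∈) (All.lookup u e'∈))))
    = disjoint-matching L us (λ a b ne → h (there a) (there b) ne)

orient : ∀ {n} → Fin n → Fin n → Edge n
orient p q = if toℕ p <ᵇ toℕ q then (p , q) else (q , p)

module _ {n : ℕ} where

  orient-cases : ∀ (p q : Fin n) →
    (orient p q ≡ (p , q) × toℕ p < toℕ q) ⊎ (orient p q ≡ (q , p) × toℕ q ≤ toℕ p)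
  orient-cases p q with toℕ p <ᵇ toℕ q in e
  ... | true = inj₁ (refl , <ᵇ-true⁻ e)
  ... | false = inj₂ (refl , <ᵇ-false⁻ e)

  orient-∈-edges : ∀ (b : Adj n) {p q} → p ≢ q → b p q ≡ true → b q p ≡ true → orient p q ∈ edges b
  orient-∈-edges b {p} {q} ne bpq bqp with orient-cases p q
  ... | inj₁ (e , lt) rewrite e = ∈-edges⁺ b lt bpq
  ... | inj₂ (e , le) rewrite e = ∈-edges⁺ b (≤∧≢⇒< le (λ z → ne (toℕ-injective (sym z)))) bqp

  orient-injective : ∀ {p q p' q' : Fin n} → orient p q ≡ orient p' q' →
    (p ≡ p' × q ≡ q') ⊎ (p ≡ q' × q ≡ p')
  orient-injective {p} {q} {p'} {q'} h with orient-cases p q | orient-cases p' q'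
  ... | inj₁ (e , _) | inj₁ (e' , _) with trans (sym e) (trans h e')
  ... | refl = inj₁ (refl , refl)
  orient-injective h | inj₁ (e , _) | inj₂ (e' , _) with trans (sym e) (trans h e')
  ... | refl = inj₂ (refl , refl)
  orient-injective h | inj₂ (e , _) | inj₁ (e' , _) with trans (sym e) (trans h e')
  ... | refl = inj₂ (refl , refl)
  orient-injective h | inj₂ (e , _) | inj₂ (e' , _) with trans (sym e) (trans h e')
  ... | refl = inj₁ (refl , refl)

  Disjoint-map : ∀ (f : Fin n → Fin n) → (∀ {x y} → f x ≡ f y → x ≡ y) →
    ∀ {a b c d} → Disjoint (a , b) (c , d) → Disjoint (f a , f b) (f c , f d)
  Disjoint-map f inj (p , q , r , s) = (λ z → p (inj z)) , (λ z → q (inj z)) , (λ z → r (inj z)) , (λ z → s (inj z))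

  Disjoint-orient : ∀ {a b c d : Fin n} → Disjoint (a , b) (c , d) → Disjoint (orient a b) (orient c d)
  Disjoint-orient {a} {b} {c} {d} (p , q , r , s) with orient-cases a b | orient-cases c d
  ... | inj₁ (e , _) | inj₁ (e' , _) rewrite e | e' = p , q , r , s
  ... | inj₁ (e , _) | inj₂ (e' , _) rewrite e | e' = q , p , s , r
  ... | inj₂ (e , _) | inj₁ (e' , _) rewrite e | e' = r , s , p , q
  ... | inj₂ (e , _) | inj₂ (e' , _) rewrite e | e' = s , r , q , p

  orient-split : ∀ {m j} {p q : Fin n} → 0 < m →
    (toℕ p ≡ j × toℕ q ≡ m + j) ⊎ (toℕ q ≡ j × toℕ p ≡ m + j) →
    toℕ (proj₁ (orient p q)) ≡ j × toℕ (proj₂ (orient p q)) ≡ m + j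
  orient-split {m} {j} {p} {q} m>0 (inj₁ (hp , hq)) with orient-cases p q
  ... | inj₁ (e , _) rewrite e = hp , hq
  ... | inj₂ (e , q≤p) = ⊥-elim (<⇒≱ (m<n+m j m>0) (subst₂ _≤_ hq hp q≤p))
  orient-split {m} {j} {p} {q} m>0 (inj₂ (hq , hp)) with orient-cases p q
  ... | inj₁ (e , p<q) = ⊥-elim (<⇒≱ (subst₂ _<_ hp hq p<q) (<⇒≤ (m<n+m j m>0)))
  ... | inj₂ (e , _) rewrite e = hq , hp

-- Vertex relabellings of Fin n.  'low m x' says that x is among the first m positions;
-- in K^k_{n-m,m} these positions form the clique K_m.
low : ∀ {n} → ℕ → Fin n → Bool
low m x = toℕ x <ᵇ m

Injective : ∀ {n} → (Fin n → Fin n) → Set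
Injective π = ∀ {x y} → π x ≡ π y → x ≡ y

module _ {n : ℕ} where

  -- The vertex at position x (for x < n); the default d is never used.
  vertexAt : ℕ → Fin n → Fin n
  vertexAt x d with x <? n
  ... | yes p = fromℕ< p
  ... | no _ = d

  toℕ-vertexAt : ∀ {x} d → x < n → toℕ (vertexAt x d) ≡ x
  toℕ-vertexAt {x} d lt with x <? n
  ... | yes p = toℕ-fromℕ< p
  ... | no np = ⊥-elim (np lt)

  swap : Fin n → Fin n → Fin n → Fin n
  swap p q x = if x ==F p then q else (if x ==F q then p else x)

  swap-hit : ∀ p q → swap p q p ≡ q
  swap-hit p q rewrite ==F-refl p = refl

  swap-miss : ∀ {p q x} → x ≢ p → x ≢ q → swap p q x ≡ x
  swap-miss a b rewrite ==F-false a | ==F-false b = refl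

  swap-involutive : ∀ p q x → swap p q (swap p q x) ≡ x
  swap-involutive p q x with x ==F p in e1
  ... | true with q ==F p in e2
  ...   | true = trans (==F-true e2) (sym (==F-true e1))
  ...   | false rewrite ==F-refl q = sym (==F-true e1)
  swap-involutive p q x | false with x ==F q in e3
  ...   | true rewrite ==F-refl p = sym (==F-true e3)
  ...   | false rewrite e1 | e3 = refl

  swap-injective : ∀ p q → Injective (swap p q)
  swap-injective p q {x} {y} h =
    trans (sym (swap-involutive p q x)) (trans (cong (swap p q) h) (swap-involutive p q y))

  swap-preserves : ∀ (P : Fin n → Bool) p q → P p ≡ P q → ∀ x → P (swap p q x) ≡ P x
  swap-preserves P p q h x with x ==F p in e1
  ... | true rewrite ==F-true e1 = sym h
  ... | false with x ==F q in e2
  ...   | true rewrite ==F-true e2 = h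
  ...   | false = refl

side-sizes : ∀ {n} (inS : Fin n → Bool) →
  n ≡ countBy inS (allFin n) + countBy (λ x → not (inS x)) (allFin n)
side-sizes {n} inS =
  trans (sym (trans (countBy-true (allFin n)) (length-tabulate (λ x → x))))
        (countBy-split (λ _ → true) inS (allFin n))

-- A relabelling 'sortBy' that moves the m vertices of S (given by inS) onto the first
-- m positions, keeping the relative order inside S and inside its complement.
module SortBy {n : ℕ} (inS : Fin n → Bool) (m : ℕ) (size : countBy inS (allFin n) ≡ m) where

  private
    rank : (Fin n → Bool) → Fin n → ℕ
    rank Q v = countBy (λ x → Q x ∧ (toℕ x <ᵇ toℕ v)) (allFin n)

    outS : Fin n → Bool
    outS x = not (inS x)

    rank-< : (Q : Fin n → Bool) → ∀ v → Q v ≡ true → rank Q v < countBy Q (allFin n)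
    rank-< Q v qv = countBy-strict _ Q (allFin n) (λ _ h → proj₁ (∧-split h)) (∈-allFin v) excl qv
      where excl : (Q v ∧ (toℕ v <ᵇ toℕ v)) ≡ false
            excl rewrite qv = <ᵇ-false {toℕ v} ≤-refl

    rank-mono : (Q : Fin n → Bool) → ∀ v w → Q v ≡ true → toℕ v < toℕ w → rank Q v < rank Q w
    rank-mono Q v w qv lt = countBy-strict _ _ (allFin n) mono (∈-allFin v) excl incl
      where
      excl : (Q v ∧ (toℕ v <ᵇ toℕ v)) ≡ false
      excl rewrite qv = <ᵇ-false {toℕ v} ≤-refl
      incl : (Q v ∧ (toℕ v <ᵇ toℕ w)) ≡ true
      incl rewrite qv = <ᵇ-true lt
      mono : ∀ {x} → x ∈ allFin n → (Q x ∧ (toℕ x <ᵇ toℕ v)) ≡ true → (Q x ∧ (toℕ x <ᵇ toℕ w)) ≡ true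
      mono {x} _ h with Q x
      ... | true = <ᵇ-true (<-trans (<ᵇ-true⁻ h) lt)

    rank-injective : (Q : Fin n → Bool) → ∀ {v w} → Q v ≡ true → Q w ≡ true → rank Q v ≡ rank Q w → v ≡ w
    rank-injective Q {v} {w} qv qw eq with <-cmp (toℕ v) (toℕ w)
    ... | tri< lt _ _ = ⊥-elim (<-irrefl eq (rank-mono Q v w qv lt))
    ... | tri≈ _ e _ = toℕ-injective e
    ... | tri> _ _ gt = ⊥-elim (<-irrefl (sym eq) (rank-mono Q w v qw gt))

    n≡ : n ≡ m + countBy outS (allFin n)
    n≡ = trans (side-sizes inS) (cong (_+ countBy outS (allFin n)) size)

  sortBy : Fin n → Fin n
  sortBy v = if inS v then vertexAt (rank inS v) v else vertexAt (m + rank outS v) v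

  private
    sortBy-in : ∀ v → inS v ≡ true → toℕ (sortBy v) ≡ rank inS v
    sortBy-in v h rewrite h =
      toℕ-vertexAt v (<-≤-trans (subst (rank inS v <_) size (rank-< inS v h))
                                (subst (m ≤_) (sym n≡) (m≤m+n m _)))

    sortBy-out : ∀ v → inS v ≡ false → toℕ (sortBy v) ≡ m + rank outS v
    sortBy-out v h rewrite h =
      toℕ-vertexAt v (subst (m + rank outS v <_) (sym n≡) (+-monoʳ-< m (rank-< outS v (cong not h))))

  sortBy-low : ∀ v → low m (sortBy v) ≡ inS v
  sortBy-low v = by-side (inS v) refl
    where
    by-side : ∀ b → inS v ≡ b → low m (sortBy v) ≡ inS v
    by-side true h = trans (cong (_<ᵇ m) (sortBy-in v h))
                           (trans (<ᵇ-true (subst (rank inS v <_) size (rank-< inS v h))) (sym h))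
    by-side false h = trans (cong (_<ᵇ m) (sortBy-out v h)) (trans (<ᵇ-false (m≤m+n m _)) (sym h))

  sortBy-injective : Injective sortBy
  sortBy-injective {v} {w} eq = by-sides (inS v) (inS w) refl refl
    where
    by-sides : ∀ b c → inS v ≡ b → inS w ≡ c → v ≡ w
    by-sides true true hv hw = rank-injective inS hv hw
      (trans (sym (sortBy-in v hv)) (trans (cong toℕ eq) (sortBy-in w hw)))
    by-sides false false hv hw = rank-injective outS (cong not hv) (cong not hw)
      (+-cancelˡ-≡ m _ _ (trans (sym (sortBy-out v hv)) (trans (cong toℕ eq) (sortBy-out w hw))))
    by-sides true false hv hw = ⊥-elim (true≢false (trans (sym hv) (trans (sym (sortBy-low v))
                                  (trans (cong (low m) eq) (trans (sortBy-low w) hw)))))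
    by-sides false true hv hw = ⊥-elim (true≢false (trans (sym hw) (trans (sym (sortBy-low w))
                                  (trans (cong (low m) (sym eq)) (trans (sortBy-low v) hv)))))

enumerateFrom : ∀ {A : Set} → ℕ → List A → List (ℕ × A)
enumerateFrom i [] = []
enumerateFrom i (c ∷ cs) = (i , c) ∷ enumerateFrom (suc i) cs

module _ {A : Set} where

  enumerateFrom-∈ : ∀ {i j} {c : A} cs → (j , c) ∈ enumerateFrom i cs →
    c ∈ cs × i ≤ j × j < i + length cs
  enumerateFrom-∈ {i} (c ∷ cs) (here refl) =
    here refl , ≤-refl , subst (i <_) (sym (+-suc i _)) (s≤s (m≤m+n i _))
  enumerateFrom-∈ {i} {j} (c ∷ cs) (there h) with enumerateFrom-∈ cs h
  ... | c∈ , i<j , j< = there c∈ , <⇒≤ i<j , subst (j <_) (sym (+-suc i (length cs))) j<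

  ∈-enumerateFrom : ∀ {i} {c : A} cs → c ∈ cs → ∃[ j ] (j , c) ∈ enumerateFrom i cs
  ∈-enumerateFrom (c ∷ cs) (here refl) = _ , here refl
  ∈-enumerateFrom (c ∷ cs) (there h) with ∈-enumerateFrom cs h
  ... | j , p = j , there p

  enumerateFrom-functional : ∀ {i j} {c c' : A} cs →
    (j , c) ∈ enumerateFrom i cs → (j , c') ∈ enumerateFrom i cs → c ≡ c'
  enumerateFrom-functional (x ∷ cs) (here refl) (here refl) = refl
  enumerateFrom-functional (x ∷ cs) (here refl) (there h) =
    ⊥-elim (<-irrefl refl (proj₁ (proj₂ (enumerateFrom-∈ cs h))))
  enumerateFrom-functional (x ∷ cs) (there h) (here refl) =
    ⊥-elim (<-irrefl refl (proj₁ (proj₂ (enumerateFrom-∈ cs h))))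
  enumerateFrom-functional (x ∷ cs) (there h) (there h') = enumerateFrom-functional cs h h'

-- For an edge c
-- crossing S, 'place i c π' adjusts π by two transpositions so that the endpoint of c
-- in S goes to position i and the other one to position m+i, without disturbing edges
-- already placed at other indices.
module Placement {n : ℕ} (inS : Fin n → Bool) (m k : ℕ) (k≤m : k ≤ m) (m+k≤n : m + k ≤ n) where

  Crosses : Edge n → Set
  Crosses (u , w) = (inS u xor inS w) ≡ true

  -- the endpoints of an edge inside and outside S (meaningful for crossing edges)
  inner outer : Edge n → Fin n
  inner (u , w) = if inS u then u else w
  outer (u , w) = if inS u then w else u

  inner-outer : ∀ c → (inner c ≡ proj₁ c × outer c ≡ proj₂ c) ⊎ (inner c ≡ proj₂ c × outer c ≡ proj₁ c)
  inner-outer (u , w) with inS u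
  ... | true = inj₁ (refl , refl)
  ... | false = inj₂ (refl , refl)

  Respects : (Fin n → Fin n) → Set
  Respects π = ∀ x → low m (π x) ≡ inS x

  Placed : (Fin n → Fin n) → ℕ → Edge n → Set
  Placed π j c = toℕ (π (inner c)) ≡ j × toℕ (π (outer c)) ≡ m + j

  low-at : ∀ {x : Fin n} {j} → toℕ x ≡ j → j < k → low m x ≡ true
  low-at e j<k = <ᵇ-true (subst (_< m) (sym e) (<-≤-trans j<k k≤m))

  high-at : ∀ {x : Fin n} {j} → toℕ x ≡ m + j → low m x ≡ false
  high-at e = <ᵇ-false (subst (m ≤_) (sym e) (m≤m+n m _))

  private
    inner-in : ∀ c → Crosses c → inS (inner c) ≡ true
    inner-in (u , w) h with inS u in e1 | inS w in e2
    ... | true | _ = e1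
    ... | false | true = e2
    ... | false | false = ⊥-elim (true≢false (sym h))

    outer-out : ∀ c → Crosses c → inS (outer c) ≡ false
    outer-out (u , w) h with inS u in e1 | inS w in e2
    ... | true | false = e2
    ... | true | true = ⊥-elim (true≢false (sym h))
    ... | false | _ = e1

    low≢high : ∀ {x y : Fin n} → low m x ≡ true → low m y ≡ false → x ≢ y
    low≢high hx hy refl = true≢false (trans (sym hx) hy)

  place : ℕ → Edge n → (Fin n → Fin n) → Fin n → Fin n
  place i c π x =
    swap (π (outer c)) (vertexAt (m + i) (π (inner c)))
      (swap (π (inner c)) (vertexAt i (π (inner c))) (π x))

  module Place {π : Fin n → Fin n} (π-inj : Injective π) (π-resp : Respects π)
               {i : ℕ} {c : Edge n} (i<k : i < k) (cross : Crosses c) where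

    private
      pA qA pB qB : Fin n
      pA = π (inner c)
      qA = vertexAt i pA
      pB = π (outer c)
      qB = vertexAt (m + i) pA

      tqA : toℕ qA ≡ i
      tqA = toℕ-vertexAt pA (<-≤-trans i<k (≤-trans k≤m (≤-trans (m≤m+n m k) m+k≤n)))
      tqB : toℕ qB ≡ m + i
      tqB = toℕ-vertexAt pA (<-≤-trans (+-monoʳ-< m i<k) m+k≤n)

      lpA : low m pA ≡ true
      lpA = trans (π-resp _) (inner-in c cross)
      lqA : low m qA ≡ true
      lqA = low-at tqA i<k
      lpB : low m pB ≡ false
      lpB = trans (π-resp _) (outer-out c cross)
      lqB : low m qB ≡ false
      lqB = high-at tqB

    injective : Injective (place i c π)
    injective h = π-inj (swap-injective pA qA (swap-injective pB qB h))

    respects : Respects (place i c π)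
    respects x = trans (swap-preserves (low m) pB qB (trans lpB (sym lqB)) _)
                   (trans (swap-preserves (low m) pA qA (trans lpA (sym lqA)) _) (π-resp x))

    placed : Placed (place i c π) i c
    placed = at-i , at-m+i
      where
      at-i : toℕ (place i c π (inner c)) ≡ i
      at-i rewrite swap-hit pA qA
                 | swap-miss {p = pB} {q = qB} {x = qA} (low≢high lqA lpB) (low≢high lqA lqB) = tqA
      at-m+i : toℕ (place i c π (outer c)) ≡ m + i
      at-m+i rewrite swap-miss {p = pA} {q = qA} {x = pB}
                       (λ e → low≢high lpA lpB (sym e)) (λ e → low≢high lqA lpB (sym e))
                   | swap-hit pB qB = tqB

    keeps : ∀ {j c'} → j < k → i ≢ j → inner c ≢ inner c' → outer c ≢ outer c' →
      Placed π j c' → Placed (place i c π) j c'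
    keeps {j} {c'} j<k i≢j da db (g1 , g2) = at-j , at-m+j
      where
      ly : low m (π (inner c')) ≡ true
      ly = low-at g1 j<k
      lz : low m (π (outer c')) ≡ false
      lz = high-at g2
      at-j : toℕ (place i c π (inner c')) ≡ j
      at-j rewrite swap-miss {p = pA} {q = qA} {x = π (inner c')} (λ e → da (sym (π-inj e)))
                     (λ e → i≢j (trans (sym tqA) (trans (cong toℕ (sym e)) g1)))
                 | swap-miss {p = pB} {q = qB} {x = π (inner c')} (low≢high ly lpB) (low≢high ly lqB) = g1
      at-m+j : toℕ (place i c π (outer c')) ≡ m + j
      at-m+j rewrite swap-miss {p = pA} {q = qA} {x = π (outer c')}
                       (λ e → low≢high lpA lz (sym e)) (λ e → low≢high lqA lz (sym e))
                   | swap-miss {p = pB} {q = qB} {x = π (outer c')} (λ e → db (sym (π-inj e)))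
                       (λ e → i≢j (+-cancelˡ-≡ m _ _ (trans (sym tqB) (trans (cong toℕ (sym e)) g2)))) = g2

  placeAll : (Edge n → Bool) → List (ℕ × Edge n) → (Fin n → Fin n) → Fin n → Fin n
  placeAll b [] π = π
  placeAll b ((i , c) ∷ L) π = placeAll b L (if b c then place i c π else π)

  Admissible : (Edge n → Bool) → List (ℕ × Edge n) → Set
  Admissible b L = ∀ {i c} → (i , c) ∈ L → b c ≡ true → i < k × Crosses c

  Separated : (Edge n → Bool) → List (Edge n) → Set
  Separated b cs = ∀ {c c'} → c ∈ cs → c' ∈ cs → b c ≡ true → b c' ≡ true → c ≢ c' →
    inner c ≢ inner c' × outer c ≢ outer c'

  placeAll-invariant : ∀ b L π → Injective π → Respects π → Admissible b L →
    Injective (placeAll b L π) × Respects (placeAll b L π)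
  placeAll-invariant b [] π inj resp adm = inj , resp
  placeAll-invariant b ((i , c) ∷ L) π inj resp adm with b c in bc
  ... | true = let i<k , cross = adm (here refl) bc in
     placeAll-invariant b L (place i c π) (Place.injective inj resp i<k cross)
       (Place.respects inj resp i<k cross) (λ h → adm (there h))
  ... | false = placeAll-invariant b L π inj resp (λ h → adm (there h))

  placeAll-keeps : ∀ b L π {j c'} → Injective π → Respects π → Admissible b L → j < k →
    (∀ {i c} → (i , c) ∈ L → b c ≡ true → i ≢ j × inner c ≢ inner c' × outer c ≢ outer c') →
    Placed π j c' → Placed (placeAll b L π) j c'
  placeAll-keeps b [] π inj resp adm j<k avoid g = g
  placeAll-keeps b ((i , c) ∷ L) π inj resp adm j<k avoid g with b c in bc
  ... | true = let i<k , cross = adm (here refl) bc ; d1 , d2 , d3 = avoid (here refl) bc in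
     placeAll-keeps b L (place i c π) (Place.injective inj resp i<k cross) (Place.respects inj resp i<k cross)
       (λ z → adm (there z)) j<k (λ z → avoid (there z)) (Place.keeps inj resp i<k cross j<k d1 d2 d3 g)
  ... | false = placeAll-keeps b L π inj resp (λ z → adm (there z)) j<k (λ z → avoid (there z)) g

  placeAll-placed : ∀ b cs i₀ π → Injective π → Respects π → Admissible b (enumerateFrom i₀ cs) →
    Unique cs → Separated b cs →
    ∀ {j c} → (j , c) ∈ enumerateFrom i₀ cs → b c ≡ true → Placed (placeAll b (enumerateFrom i₀ cs) π) j c
  placeAll-placed b (c ∷ cs) i₀ π inj resp adm u sep (here refl) bc rewrite bc =
    let i<k , cross = adm (here refl) bc in
    placeAll-keeps b (enumerateFrom (suc i₀) cs) (place i₀ c π)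
      (Place.injective inj resp i<k cross) (Place.respects inj resp i<k cross) (λ z → adm (there z)) i<k
      (λ z bz → let c''∈ , le , _ = enumerateFrom-∈ cs z in
         (λ e → <-irrefl (sym e) le) ,
         sep (there c''∈) (here refl) bz bc (λ e → Unique[x∷xs]⇒x∉xs u (subst (_∈ cs) e c''∈)))
      (Place.placed inj resp i<k cross)
  placeAll-placed b (c ∷ cs) i₀ π inj resp adm u sep (there h) bc' with b c in bc
  ... | true = let i<k , cross = adm (here refl) bc in
     placeAll-placed b cs (suc i₀) (place i₀ c π) (Place.injective inj resp i<k cross)
       (Place.respects inj resp i<k cross) (λ z → adm (there z)) (tail-unique u)
       (λ a a' → sep (there a) (there a')) h bc'
  ... | false = placeAll-placed b cs (suc i₀) π inj resp (λ z → adm (there z)) (tail-unique u)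
       (λ a a' → sep (there a) (there a')) h bc'

  placeAll-cong : ∀ b b' L π → (∀ {i c} → (i , c) ∈ L → b c ≡ b' c) → placeAll b L π ≡ placeAll b' L π
  placeAll-cong b b' [] π h = refl
  placeAll-cong b b' ((i , c) ∷ L) π h rewrite h (here refl) = placeAll-cong b b' L _ (λ z → h (there z))

  private
    via : ∀ {x x' y y' : Fin n} → x ≡ y → x' ≡ y' → y ≢ y' → x ≢ x'
    via refl refl ne = ne

  Disjoint-separates : ∀ {c c'} → Disjoint c c' → inner c ≢ inner c' × outer c ≢ outer c'
  Disjoint-separates {c} {c'} (p , q , r , s) with inner-outer c | inner-outer c'
  ... | inj₁ (e1 , f1) | inj₁ (e2 , f2) = via e1 e2 p , via f1 f2 s
  ... | inj₁ (e1 , f1) | inj₂ (e2 , f2) = via e1 e2 q , via f1 f2 r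
  ... | inj₂ (e1 , f1) | inj₁ (e2 , f2) = via e1 e2 r , via f1 f2 q
  ... | inj₂ (e1 , f1) | inj₂ (e2 , f2) = via e1 e2 s , via f1 f2 p

  placed-endpoints : ∀ {π j c} → Placed π j c →
    (toℕ (π (proj₁ c)) ≡ j × toℕ (π (proj₂ c)) ≡ m + j) ⊎ (toℕ (π (proj₂ c)) ≡ j × toℕ (π (proj₁ c)) ≡ m + j)
  placed-endpoints {π} {c = c} (g1 , g2) with inner-outer c
  ... | inj₁ (e1 , e2) = inj₁ (subst (λ z → toℕ (π z) ≡ _) e1 g1 , subst (λ z → toℕ (π z) ≡ _) e2 g2)
  ... | inj₂ (e1 , e2) = inj₂ (subst (λ z → toℕ (π z) ≡ _) e1 g1 , subst (λ z → toℕ (π z) ≡ _) e2 g2)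

  lands-on-cross⇒Crosses : ∀ {π} → Respects π → ∀ {u w j} → j < k →
    toℕ (proj₁ (orient (π u) (π w))) ≡ j → toℕ (proj₂ (orient (π u) (π w))) ≡ m + j → Crosses (u , w)
  lands-on-cross⇒Crosses {π} resp {u} {w} j<k at-j at-m+j with orient-cases (π u) (π w)
  ... | inj₁ (e , _) =
    cong₂ _xor_ (trans (sym (resp u)) (low-at (trans (cong (toℕ ∘ proj₁) (sym e)) at-j) j<k))
                (trans (sym (resp w)) (high-at (trans (cong (toℕ ∘ proj₂) (sym e)) at-m+j)))
  ... | inj₂ (e , _) =
    cong₂ _xor_ (trans (sym (resp u)) (high-at (trans (cong (toℕ ∘ proj₂) (sym e)) at-m+j)))
                (trans (sym (resp w)) (low-at (trans (cong (toℕ ∘ proj₁) (sym e)) at-j) j<k))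

module _ {n m k : ℕ} where

  Kkm-same-side : ∀ {p q : Fin n} → p ≢ q → low m p ≡ low m q → Kkm n m k p q ≡ true
  Kkm-same-side {p} {q} ne h rewrite ==F-false ne | sym h with low m p
  ... | true = refl
  ... | false = refl

  Kkm-cross : ∀ {p q : Fin n} {j} → toℕ p ≡ j → toℕ q ≡ m + j → j < k →
    Kkm n m k p q ≡ true × Kkm n m k q p ≡ true
  Kkm-cross {p} {q} {j} e1 e2 j<k = forward , backward
    where
    ≡ᵇ-refl : ∀ x → (x ≡ᵇ x) ≡ true
    ≡ᵇ-refl x = T→≡ (≡⇒≡ᵇ x x refl)
    forward : Kkm n m k p q ≡ true
    forward rewrite e1 | e2 | <ᵇ-true j<k | ≡ᵇ-refl (m + j) = ∨-zeroʳ _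
    backward : Kkm n m k q p ≡ true
    backward rewrite e1 | e2 | <ᵇ-true j<k | ≡ᵇ-refl (m + j) =
      trans (cong ((sameSide m (m + j) j ∧ not (q ==F p)) ∨_) (∨-zeroʳ (cross m k (m + j) j)))
            (∨-zeroʳ _)

-- Number the crossing edges c₀,…,c_{k-1}.  A matching M of G is sent, through
-- the relabelling σ_M = "sort S to the front, then place each cᵢ ∈ M onto {i , m+i}", to
-- the matching σ_M(M) of K^k_{n-m,m}: non-crossing edges stay inside a clique and the
-- crossing edges of M become cross edges.  From σ_M(M) one reads off which cᵢ lie in M
-- (exactly those with an image on {i , m+i}), hence σ_M, hence M.
module MatchingInjection {n : ℕ} (G : SimpleGraph n) (S : Subset n) (m k : ℕ)
  (size : countBy (lookup S) (allFin n) ≡ m) (k≤m : k ≤ m) (m+k≤n : m + k ≤ n)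
  (cut : cutSize G S ≡ k) where

  private
    a : Adj n
    a = adj G
    K : Adj n
    K = Kkm n m k
    inS : Fin n → Bool
    inS = lookup S

  open Placement inS m k k≤m m+k≤n
  open SortBy inS m size
  open DecMembership (≡-dec× (_≟F_ {n}) (_≟F_ {n})) using (_∈?_)

  crossesᵇ : Edge n → Bool
  crossesᵇ (u , w) = inS u xor inS w

  crossing : List (Edge n)
  crossing = filterB crossesᵇ (edges a)

  crossing-length : length crossing ≡ k
  crossing-length = trans (sym (countBy-length crossesᵇ (edges a))) cut

  crossing-unique : Unique crossing
  crossing-unique = filterB-unique crossesᵇ (edges-unique a)

  numbered : List (ℕ × Edge n)
  numbered = enumerateFrom 0 crossing

  numbered-< : ∀ {j c} → (j , c) ∈ numbered → j < k
  numbered-< h = subst (_ <_) crossing-length (proj₂ (proj₂ (enumerateFrom-∈ crossing h)))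

  numbered-∃ : ∀ {c} → c ∈ edges a → crossesᵇ c ≡ true → ∃[ j ] (j , c) ∈ numbered
  numbered-∃ c∈ cr = ∈-enumerateFrom crossing (∈-filterB crossesᵇ (edges a) c∈ cr)

  chosen : List (Edge n) → Edge n → Bool
  chosen M c = isYes (c ∈? M)

  chosen-true : ∀ {M c} → c ∈ M → chosen M c ≡ true
  chosen-true {M} {c} h with c ∈? M
  ... | yes _ = refl
  ... | no ¬h = ⊥-elim (¬h h)

  chosen-true⁻ : ∀ {M c} → chosen M c ≡ true → c ∈ M
  chosen-true⁻ {M} {c} h with c ∈? M
  ... | yes p = p
  ... | no _ = ⊥-elim (true≢false (sym h))

  σ : List (Edge n) → Fin n → Fin n
  σ M = placeAll (chosen M) numbered sortBy

  private
    admissible : ∀ M → Admissible (chosen M) numbered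
    admissible M h _ = numbered-< h , proj₂ (filterB-∈ crossesᵇ (edges a) (proj₁ (enumerateFrom-∈ crossing h)))

  σ-injective : ∀ M → Injective (σ M)
  σ-injective M = proj₁ (placeAll-invariant (chosen M) numbered sortBy sortBy-injective sortBy-low (admissible M))

  σ-respects : ∀ M → Respects (σ M)
  σ-respects M = proj₂ (placeAll-invariant (chosen M) numbered sortBy sortBy-injective sortBy-low (admissible M))

  IsMatching : List (Edge n) → Set
  IsMatching M = M ∈ sublists (edges a) × isMatching M ≡ true

  σ-placed : ∀ {M} → IsMatching M → ∀ {j c} → (j , c) ∈ numbered → c ∈ M → Placed (σ M) j c
  σ-placed {M} (_ , mat) h c∈M =
    placeAll-placed (chosen M) crossing 0 sortBy sortBy-injective sortBy-low (admissible M)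
      crossing-unique separated h (chosen-true c∈M)
    where
    separated : Separated (chosen M) crossing
    separated {c} {c'} _ _ b b' ne =
      Disjoint-separates (matching-disjoint mat (chosen-true⁻ {M} {c} b) (chosen-true⁻ {M} {c'} b') ne)

  image : List (Edge n) → Edge n → Edge n
  image M (u , w) = orient (σ M u) (σ M w)

  image-crossing : ∀ {M} → IsMatching M → ∀ {j c} → (j , c) ∈ numbered → c ∈ M →
    toℕ (proj₁ (image M c)) ≡ j × toℕ (proj₂ (image M c)) ≡ m + j
  image-crossing {M} mat {j} {c} h c∈M =
    orient-split {m = m} {j = j} (<-≤-trans (≤-<-trans z≤n (numbered-< h)) k≤m)
      (placed-endpoints {σ M} {j} {c} (σ-placed mat h c∈M))

  image-∈-K : ∀ {M} → IsMatching M → ∀ {e} → e ∈ M → image M e ∈ edges K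
  image-∈-K {M} mat {x , y} e∈M with crossesᵇ (x , y) in cr
  ... | true = let j , h = numbered-∃ e∈a cr in
    as-edge (placed-endpoints {σ M} {j} {x , y} (σ-placed mat h e∈M)) (numbered-< h)
    where
    e∈a : (x , y) ∈ edges a
    e∈a = sublist-⊆ (proj₁ mat) e∈M
    ne : σ M x ≢ σ M y
    ne z = edge-endpoints-≢ a e∈a (σ-injective M z)
    as-edge : ∀ {j} → (toℕ (σ M x) ≡ j × toℕ (σ M y) ≡ m + j) ⊎ (toℕ (σ M y) ≡ j × toℕ (σ M x) ≡ m + j) →
      j < k → image M (x , y) ∈ edges K
    as-edge (inj₁ (hx , hy)) j<k = let kxy , kyx = Kkm-cross hx hy j<k in orient-∈-edges K ne kxy kyx
    as-edge (inj₂ (hy , hx)) j<k = let kyx , kxy = Kkm-cross hy hx j<k in orient-∈-edges K ne kxy kyx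
  ... | false = orient-∈-edges K ne (Kkm-same-side {m = m} {k} ne same) (Kkm-same-side {m = m} {k} (λ z → ne (sym z)) (sym same))
    where
    ne : σ M x ≢ σ M y
    ne z = edge-endpoints-≢ a (sublist-⊆ (proj₁ mat) e∈M) (σ-injective M z)
    same : low m (σ M x) ≡ low m (σ M y)
    same = trans (σ-respects M x) (trans (xor-false⁻ cr) (sym (σ-respects M y)))

  image-injective : ∀ M {e e'} → e ∈ edges a → e' ∈ edges a → image M e ≡ image M e' → e ≡ e'
  image-injective M {x , y} {x' , y'} e∈ e'∈ eq with orient-injective eq
  ... | inj₁ (p , q) = cong₂ _,_ (σ-injective M p) (σ-injective M q)
  ... | inj₂ (p , q) with σ-injective M p | σ-injective M q
  ... | refl | refl = ⊥-elim (<-asym (proj₁ (∈-edges⁻ a e∈)) (proj₁ (∈-edges⁻ a e'∈)))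

  -- φ(M): the image edges, listed in the order of 'edges K' so that φ(M) ∈ sublists (edges K)
  φ : List (Edge n) → List (Edge n)
  φ M = filterB (chosen (map (image M) M)) (edges K)

  φ-⊆ : ∀ {M e} → e ∈ φ M → e ∈ map (image M) M
  φ-⊆ {M} h = chosen-true⁻ (proj₂ (filterB-∈ _ (edges K) h))

  ⊆-φ : ∀ {M} → IsMatching M → ∀ {e} → e ∈ map (image M) M → e ∈ φ M
  ⊆-φ {M} mat h with ∈-map⁻ (image M) h
  ... | e , e∈M , refl = ∈-filterB _ (edges K) (image-∈-K mat e∈M) (chosen-true h)

  φ-length : ∀ {M} → IsMatching M → length (φ M) ≡ length M
  φ-length {M} mat = trans
    (≤-antisym (unique-length-≤ (≡-dec× _≟F_ _≟F_) (filterB-unique _ (edges-unique K)) φ-⊆)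
               (unique-length-≤ (≡-dec× _≟F_ _≟F_) images-unique (⊆-φ mat)))
    (length-map (image M) M)
    where
    images-unique : Unique (map (image M) M)
    images-unique = map-unique (image M) (sublist-unique (edges-unique a) (proj₁ mat))
      (λ p q → image-injective M (sublist-⊆ (proj₁ mat) p) (sublist-⊆ (proj₁ mat) q))

  φ-matching : ∀ {M} → IsMatching M → isMatching (φ M) ≡ true
  φ-matching {M} mat = disjoint-matching (φ M) (filterB-unique _ (edges-unique K))
    λ h h' ne → images-disjoint (φ-⊆ h) (φ-⊆ h') ne
    where
    images-disjoint : ∀ {e e'} → e ∈ map (image M) M → e' ∈ map (image M) M → e ≢ e' → Disjoint e e'
    images-disjoint h h' ne with ∈-map⁻ (image M) h | ∈-map⁻ (image M) h'
    ... | f , f∈ , refl | f' , f'∈ , refl =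
      Disjoint-orient (Disjoint-map (σ M) (σ-injective M)
        (matching-disjoint (proj₂ mat) f∈ f'∈ (λ z → ne (cong (image M) z))))

  -- Reading the crossing edges back: if every image edge of M is one of M', then each
  -- crossing edge c_j of M lies in M' (the only edge of M' landing on {j , m+j} is c_j).
  crossing-recovered : ∀ {M M'} → IsMatching M → IsMatching M' →
    (∀ {e} → e ∈ map (image M) M → e ∈ map (image M') M') →
    ∀ {j c} → (j , c) ∈ numbered → c ∈ M → c ∈ M'
  crossing-recovered {M} {M'} mat mat' images⊆ {j} {c} h c∈M
    with ∈-map⁻ (image M') (images⊆ (∈-map⁺ (image M) c∈M))
  ... | c' , c'∈M' , eq with numbered-∃ (sublist-⊆ (proj₁ mat') c'∈M') c'-crosses
    where
    at : toℕ (proj₁ (image M' c')) ≡ j × toℕ (proj₂ (image M' c')) ≡ m + j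
    at = subst (λ e → toℕ (proj₁ e) ≡ j × toℕ (proj₂ e) ≡ m + j) eq (image-crossing mat h c∈M)
    c'-crosses : crossesᵇ c' ≡ true
    c'-crosses = lands-on-cross⇒Crosses (σ-respects M') (numbered-< h) (proj₁ at) (proj₂ at)
  ... | j' , h' = subst (_∈ M') (sym c≡c') c'∈M'
    where
    j'≡j : j' ≡ j
    j'≡j = trans (sym (proj₁ (image-crossing mat' h' c'∈M')))
                 (trans (cong (toℕ ∘ proj₁) (sym eq)) (proj₁ (image-crossing mat h c∈M)))
    c≡c' : c ≡ c'
    c≡c' = enumerateFrom-functional crossing h (subst (λ z → (z , c') ∈ numbered) j'≡j h')

  ⊆-from-images : ∀ {M M'} → IsMatching M → IsMatching M' → σ M ≡ σ M' →
    (∀ {e} → e ∈ map (image M) M → e ∈ map (image M') M') → ∀ {e} → e ∈ M → e ∈ M'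
  ⊆-from-images {M} {M'} mat mat' σ≡ images⊆ {e} e∈M with ∈-map⁻ (image M') (images⊆ (∈-map⁺ (image M) e∈M))
  ... | e' , e'∈M' , eq = subst (_∈ M') (sym e≡e') e'∈M'
    where
    e≡e' : e ≡ e'
    e≡e' = image-injective M' (sublist-⊆ (proj₁ mat) e∈M) (sublist-⊆ (proj₁ mat') e'∈M')
      (trans (cong (λ s → orient (s (proj₁ e)) (s (proj₂ e))) (sym σ≡)) eq)

  φ-injective : ∀ {M M'} → IsMatching M → IsMatching M' → φ M ≡ φ M' → M ≡ M'
  φ-injective {M} {M'} mat mat' eq =
    sublist-ext (edges-unique a) (proj₁ mat) (proj₁ mat')
      (⊆-from-images mat mat' σ≡ images⊆) (⊆-from-images mat' mat (sym σ≡) images⊇)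
    where
    images⊆ : ∀ {e} → e ∈ map (image M) M → e ∈ map (image M') M'
    images⊆ {e} h = φ-⊆ (subst (e ∈_) eq (⊆-φ mat h))
    images⊇ : ∀ {e} → e ∈ map (image M') M' → e ∈ map (image M) M
    images⊇ {e} h = φ-⊆ (subst (e ∈_) (sym eq) (⊆-φ mat' h))
    same-choice : ∀ {i c} → (i , c) ∈ numbered → chosen M c ≡ chosen M' c
    same-choice {c = c} h with c ∈? M | c ∈? M'
    ... | yes _ | yes _ = refl
    ... | no _ | no _ = refl
    ... | yes c∈M | no c∉M' = ⊥-elim (c∉M' (crossing-recovered mat mat' images⊆ h c∈M))
    ... | no c∉M | yes c∈M' = ⊥-elim (c∉M (crossing-recovered mat' mat images⊇ h c∈M'))
    σ≡ : σ M ≡ σ M'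
    σ≡ = placeAll-cong (chosen M) (chosen M') numbered sortBy same-choice

  matchCount-≤ : ∀ t → matchCount a t ≤ matchCount K t
  matchCount-≤ t = count-injection (≡-decL (≡-dec× _≟F_ _≟F_)) is-t-matching is-t-matching
      (sublists (edges a)) (sublists (edges K)) φ (sublists-unique (edges-unique a)) maps-into injective
    where
    is-t-matching : List (Edge n) → Bool
    is-t-matching M = (length M ≡ᵇ t) ∧ isMatching M
    matching : ∀ {M} → M ∈ sublists (edges a) → is-t-matching M ≡ true → IsMatching M
    matching h tm = h , proj₂ (∧-split tm)
    maps-into : ∀ {M} → M ∈ sublists (edges a) → is-t-matching M ≡ true →
      φ M ∈ sublists (edges K) × is-t-matching (φ M) ≡ true
    maps-into {M} h tm = filterB-sublist _ (edges K) ,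
      cong₂ _∧_ (trans (cong (_≡ᵇ t) (φ-length (matching h tm))) (proj₁ (∧-split tm)))
                (φ-matching (matching h tm))
    injective : ∀ {M M'} → M ∈ sublists (edges a) → M' ∈ sublists (edges a) →
      is-t-matching M ≡ true → is-t-matching M' ≡ true → φ M ≡ φ M' → M ≡ M'
    injective h h' tm tm' = φ-injective (matching h tm) (matching h' tm')

degree-count-arith : ∀ s k → 1 ≤ s → s ≤ k → k < s * ((k + 1) ∸ (s ∸ 1))
degree-count-arith (suc a) k _ s≤k =
  <-≤-trans (subst (k <_) (sym c+a≡) (subst (k <_) (+-comm 1 k) (n<1+n k))) (+-monoʳ-≤ c a≤a*c)
  where
  c : ℕ
  c = (k + 1) ∸ a
  a≤k : a ≤ k
  a≤k = <⇒≤ s≤k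
  c+a≡ : c + a ≡ k + 1
  c+a≡ = m∸n+n≡m (≤-trans a≤k (m≤m+n k 1))
  a≤a*c : a ≤ a * c
  a≤a*c = subst (_≤ a * c) (*-identityʳ a) (*-monoʳ-≤ a (m<n⇒0<n∸m (subst (a <_) (+-comm 1 k) (s≤s a≤k))))

-- If every vertex has degree ≥ k+1 and S (with s ≥ 1 vertices) has
-- |∂(S)| = k, then s > k: otherwise each v ∈ S has at most s−1 neighbours inside S,
-- hence at least k+1−(s−1) edges of ∂(S), and these edge sets are disjoint for
-- distinct v, giving |∂(S)| ≥ s·(k+2−s) > k.
module DegreeCount {n : ℕ} (G : SimpleGraph n) (S : Subset n) where

  private
    a : Adj n
    a = adj G
    inS : Fin n → Bool
    inS = lookup S

    incident : Fin n → Edge n → Bool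
    incident v (x , y) = (x ==F v) xor (y ==F v)

    crossesᵇ : Edge n → Bool
    crossesᵇ (x , y) = inS x xor inS y

    internalAt cutAt : Fin n → List (Edge n)
    internalAt v = filterB (λ e → incident v e ∧ not (crossesᵇ e)) (edges a)
    cutAt v = filterB (λ e → incident v e ∧ crossesᵇ e) (edges a)

    degree : Fin n → ℕ
    degree v = countBy (incident v) (edges a)

    sizeS : ℕ
    sizeS = countBy inS (allFin n)

    membersS : List (Fin n)
    membersS = filterB inS (allFin n)

    degree-cutSize : ∀ v → cutSize G (singleton v) ≡ degree v
    degree-cutSize v = countBy-cong _ (incident v) (edges a)
      (λ { {x , y} _ → cong₂ _xor_ (lookup∘tabulate _ x) (lookup∘tabulate _ y) })

    degree-split : ∀ v → degree v ≡ length (cutAt v) + length (internalAt v)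
    degree-split v = trans (countBy-split (incident v) crossesᵇ (edges a))
      (cong₂ _+_ (countBy-length _ (edges a)) (countBy-length _ (edges a)))

    other : Fin n → Edge n → Fin n
    other v (x , y) = if x ==F v then y else x

    other-cases : ∀ {v x y} → incident v (x , y) ≡ true →
      (x ≡ v × other v (x , y) ≡ y) ⊎ (y ≡ v × other v (x , y) ≡ x × x ≢ v)
    other-cases {v} {x} {y} h with x ==F v in e1 | y ==F v in e2
    ... | true | _ = inj₁ (==F-true e1 , refl)
    ... | false | true = inj₂ (==F-true e2 , refl , ==F-false⁻ e1)
    ... | false | false = ⊥-elim (true≢false (sym h))

    -- v and the other ends of its edges inside S are distinct vertices of S
    internal-bound : ∀ v → inS v ≡ true → suc (length (internalAt v)) ≤ sizeS
    internal-bound v v∈S =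
      subst₂ _≤_ (cong suc (length-map (other v) (internalAt v))) (sym (countBy-length inS (allFin n)))
        (unique-length-≤ _≟F_ distinct ⊆S)
      where
      info : ∀ {x y} → (x , y) ∈ internalAt v → (x , y) ∈ edges a × incident v (x , y) ≡ true × inS x ≡ inS y
      info h = let e∈ , p = filterB-∈ _ (edges a) h ; inc , notcr = ∧-split p
               in e∈ , inc , xor-false⁻ (not-true⁻ notcr)
      other≢v : ∀ {e} → e ∈ internalAt v → other v e ≢ v
      other≢v {x , y} h with info h
      ... | e∈ , inc , _ with other-cases {v} {x} {y} inc
      ... | inj₁ (refl , o) = λ z → edge-endpoints-≢ a e∈ (sym (trans (sym o) z))
      ... | inj₂ (_ , o , x≢v) = λ z → x≢v (trans (sym o) z)
      other∈S : ∀ {e} → e ∈ internalAt v → inS (other v e) ≡ true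
      other∈S {x , y} h with info h
      ... | _ , inc , same with other-cases {v} {x} {y} inc
      ... | inj₁ (refl , o) = trans (cong inS o) (trans (sym same) v∈S)
      ... | inj₂ (refl , o , _) = trans (cong inS o) (trans same v∈S)
      other-injective : ∀ {e e'} → e ∈ internalAt v → e' ∈ internalAt v → other v e ≡ other v e' → e ≡ e'
      other-injective {x , y} {x' , y'} h h' eq with info h | info h'
      ... | e∈ , inc , _ | e'∈ , inc' , _ with other-cases {v} {x} {y} inc | other-cases {v} {x'} {y'} inc'
      ... | inj₁ (refl , o) | inj₁ (refl , o') = cong (v ,_) (trans (sym o) (trans eq o'))
      ... | inj₂ (refl , o , _) | inj₂ (refl , o' , _) = cong (_, v) (trans (sym o) (trans eq o'))
      ... | inj₁ (refl , o) | inj₂ (refl , o' , _) =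
        ⊥-elim (<-asym (proj₁ (∈-edges⁻ a e∈))
          (subst (λ w → toℕ w < toℕ v) (sym (trans (sym o) (trans eq o'))) (proj₁ (∈-edges⁻ a e'∈))))
      ... | inj₂ (refl , o , _) | inj₁ (refl , o') =
        ⊥-elim (<-asym (proj₁ (∈-edges⁻ a e'∈))
          (subst (λ w → toℕ w < toℕ v) (trans (sym o) (trans eq o')) (proj₁ (∈-edges⁻ a e∈))))
      distinct : Unique (v ∷ map (other v) (internalAt v))
      distinct = ∉-unique (λ h → let e , e∈ , eq = ∈-map⁻ (other v) h in other≢v e∈ (sym eq))
                          (map-unique (other v) (filterB-unique _ (edges-unique a)) other-injective)
      ⊆S : ∀ {z} → z ∈ v ∷ map (other v) (internalAt v) → z ∈ membersS
      ⊆S (here refl) = ∈-filterB inS (allFin n) (∈-allFin v) v∈S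
      ⊆S (there h) = let e , e∈ , eq = ∈-map⁻ (other v) h in
        subst (_∈ membersS) (sym eq) (∈-filterB inS (allFin n) (∈-allFin _) (other∈S e∈))

    cutAt-apart : ∀ {v v' e} → inS v ≡ true → inS v' ≡ true → e ∈ cutAt v → e ∈ cutAt v' → v ≡ v'
    cutAt-apart {v} {v'} {x , y} v∈S v'∈S h h'
      with ∧-split (proj₂ (filterB-∈ _ (edges a) h)) | ∧-split (proj₂ (filterB-∈ _ (edges a) h'))
    ... | inc , cr | inc' , _ with ends inc | ends inc'
      where
      ends : ∀ {w} → incident w (x , y) ≡ true → x ≡ w ⊎ y ≡ w
      ends {w} i with x ==F w in e1 | y ==F w in e2
      ... | true | _ = inj₁ (==F-true e1)
      ... | false | true = inj₂ (==F-true e2)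
      ... | false | false = ⊥-elim (true≢false (sym i))
    ... | inj₁ e | inj₁ e' = trans (sym e) e'
    ... | inj₂ e | inj₂ e' = trans (sym e) e'
    ... | inj₁ e | inj₂ e' = ⊥-elim (true≢false (trans (sym cr)
          (cong₂ _xor_ (trans (cong inS e) v∈S) (trans (cong inS e') v'∈S))))
    ... | inj₂ e | inj₁ e' = ⊥-elim (true≢false (trans (sym cr)
          (cong₂ _xor_ (trans (cong inS e') v'∈S) (trans (cong inS e) v∈S))))

    cut-edges-bound : length (concatMap cutAt membersS) ≤ cutSize G S
    cut-edges-bound = subst (length (concatMap cutAt membersS) ≤_) (sym (countBy-length crossesᵇ (edges a)))
      (unique-length-≤ (≡-dec× _≟F_ _≟F_)
        (concatMap-unique cutAt (filterB-unique inS (allFin⁺ n)) (λ v → filterB-unique _ (edges-unique a)) apart)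
        ⊆cut)
      where
      apart : ∀ {v v' e} → v ∈ membersS → v' ∈ membersS → e ∈ cutAt v → e ∈ cutAt v' → v ≡ v'
      apart v∈ v'∈ = cutAt-apart (proj₂ (filterB-∈ inS (allFin n) v∈)) (proj₂ (filterB-∈ inS (allFin n) v'∈))
      ⊆cut : ∀ {e} → e ∈ concatMap cutAt membersS → e ∈ filterB crossesᵇ (edges a)
      ⊆cut h = let v , _ , e∈ = find (∈-concatMap⁻ cutAt {xs = membersS} h)
                   e∈a , p = filterB-∈ _ (edges a) e∈
               in ∈-filterB crossesᵇ (edges a) e∈a (proj₂ (∧-split p))

  side-exceeds : ∀ {k} → 1 ≤ countBy inS (allFin n) → (∀ v → k + 1 ≤ cutSize G (singleton v)) →
    cutSize G S ≡ k → k < countBy inS (allFin n)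
  side-exceeds {k} s≥1 min-degree cut with sizeS ≤? k
  ... | no s≰k = ≰⇒> s≰k
  ... | yes s≤k = ⊥-elim (<-irrefl refl (begin-strict
      k                                    <⟨ degree-count-arith sizeS k s≥1 s≤k ⟩
      sizeS * c                            ≤⟨ ≤-reflexive (cong (_* c) (countBy-length inS (allFin n))) ⟩
      length membersS * c                  ≤⟨ length-concatMap-≥ cutAt membersS c each ⟩
      length (concatMap cutAt membersS)    ≤⟨ cut-edges-bound ⟩
      cutSize G S                          ≡⟨ cut ⟩
      k                                    ∎))
    where
    open ≤-Reasoning
    c : ℕ
    c = (k + 1) ∸ (sizeS ∸ 1)
    each : ∀ {v} → v ∈ membersS → c ≤ length (cutAt v)
    each {v} h = let v∈S = proj₂ (filterB-∈ inS (allFin n) h) ; i = length (internalAt v) in begin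
      (k + 1) ∸ (sizeS ∸ 1)              ≤⟨ ∸-monoʳ-≤ (k + 1) (∸-monoˡ-≤ 1 (internal-bound v v∈S)) ⟩
      (k + 1) ∸ i                        ≤⟨ ∸-monoˡ-≤ i (subst (k + 1 ≤_) (degree-cutSize v) (min-degree v)) ⟩
      degree v ∸ i                       ≡⟨ cong (_∸ i) (degree-split v) ⟩
      length (cutAt v) + i ∸ i           ≡⟨ m+n∸n≡m (length (cutAt v)) i ⟩
      length (cutAt v)                   ∎

min-degree : ∀ {n k} (G : SimpleGraph n) → 2 ≤ n →
  (∀ (S : Subset n) → NonemptyProper S → k ≤ cutSize G S) → NoTrivialCut G k →
  ∀ v → k + 1 ≤ cutSize G (singleton v)
min-degree {n} {k} G n≥2 lower no-trivial v =
  subst (_≤ cutSize G (singleton v)) (+-comm 1 k)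
    (≤∧≢⇒< (lower (singleton v) nonempty-proper) (λ e → no-trivial v (sym e)))
  where
  another : ∀ {n} → 2 ≤ n → (v : Fin n) → ∃[ w ] w ≢ v
  another {suc zero} (s≤s ()) _
  another {suc (suc n)} _ Fin.zero = Fin.suc Fin.zero , λ ()
  another {suc (suc n)} _ (Fin.suc v) = Fin.zero , λ ()
  nonempty-proper : NonemptyProper (singleton v)
  nonempty-proper =
    (v , trans (lookup∘tabulate (_==F v) v) (==F-refl v)) ,
    (proj₁ (another n≥2 v) , trans (lookup∘tabulate (_==F v) (proj₁ (another n≥2 v))) (==F-false (proj₂ (another n≥2 v))))

complement-cut : ∀ {n} (G : SimpleGraph n) (S : Subset n) → cutSize G (Vec.map not S) ≡ cutSize G S
complement-cut G S = countBy-cong _ _ (edges (adj G))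
  (λ { {i , j} _ → trans (cong₂ _xor_ (lookup-map i not S) (lookup-map j not S)) (not-xor (lookup S i) (lookup S j)) })
  where
  not-xor : ∀ p q → (not p xor not q) ≡ (p xor q)
  not-xor true true = refl
  not-xor true false = refl
  not-xor false true = refl
  not-xor false false = refl

complement-sizes : ∀ {n} (S : Subset n) →
  countBy (lookup (Vec.map not S)) (allFin n) ≡ countBy (λ x → not (lookup S x)) (allFin n) ×
  countBy (λ x → not (lookup (Vec.map not S) x)) (allFin n) ≡ countBy (lookup S) (allFin n)
complement-sizes {n} S =
  countBy-cong _ _ (allFin n) (λ {x} _ → lookup-map x not S) ,
  countBy-cong _ _ (allFin n) (λ {x} _ → trans (cong not (lookup-map x not S)) (not-involutive (lookup S x)))

from-smaller-side : ∀ {n k} (G : SimpleGraph n) (T : Subset n) → 1 ≤ k → cutSize G T ≡ k →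
  k < countBy (lookup T) (allFin n) →
  countBy (lookup T) (allFin n) ≤ countBy (λ x → not (lookup T x)) (allFin n) →
  ∃[ m ] ((k ⊔ 2 ≤ m) × (m ≤ n / 2) × (adj G ⪯ Kkm n m k))
from-smaller-side {n} {k} G T k≥1 cut k<s s≤s' =
  s , ⊔-lub (<⇒≤ k<s) (≤-trans (s≤s k≥1) k<s) , s≤n/2 ,
  λ t _ → MatchingInjection.matchCount-≤ G T s k refl (<⇒≤ k<s) s+k≤n cut t
  where
  s s' : ℕ
  s = countBy (lookup T) (allFin n)
  s' = countBy (λ x → not (lookup T x)) (allFin n)
  n≡ : n ≡ s + s'
  n≡ = side-sizes (lookup T)
  s+k≤n : s + k ≤ n
  s+k≤n = subst (s + k ≤_) (sym n≡) (+-monoʳ-≤ s (≤-trans (<⇒≤ k<s) s≤s'))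
  s≤n/2 : s ≤ n / 2
  s≤n/2 = subst (_≤ n / 2) (m*n/n≡m s 2) (/-monoˡ-≤ 2 (begin
    s * 2        ≡⟨ *-comm s 2 ⟩
    s + (s + 0)  ≡⟨ cong (s +_) (+-identityʳ s) ⟩
    s + s        ≤⟨ +-monoʳ-≤ s s≤s' ⟩
    s + s'       ≡⟨ sym n≡ ⟩
    n            ∎))
    where open ≤-Reasoning

lemma2p4 : (n : ℕ) (k : ℕ) (G : SimpleGraph n) →
    2 ≤ n → 1 ≤ k → k ≤ n ∸ 1 →
    Connected G → EdgeConnectivity G k → NoTrivialCut G k →
    ∃[ m ] ((k ⊔ 2 ≤ m) × (m ≤ n / 2) × (adj G ⪯ Kkm n m k))
lemma2p4 n k G n≥2 k≥1 _ _ (lower , S , ((x , x∈S) , (y , y∉S)) , cut) no-trivial =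
  take-smaller-side (size S ≤? size S′)
  where
  size : Subset n → ℕ
  size T = countBy (lookup T) (allFin n)
  S′ : Subset n
  S′ = Vec.map not S
  cut′ : cutSize G S′ ≡ k
  cut′ = trans (complement-cut G S) cut
  degrees : ∀ v → k + 1 ≤ cutSize G (singleton v)
  degrees = min-degree G n≥2 lower no-trivial
  k<s : k < size S
  k<s = DegreeCount.side-exceeds G S (countBy-positive (lookup S) (∈-allFin x) x∈S) degrees cut
  k<s′ : k < size S′
  k<s′ = DegreeCount.side-exceeds G S′
    (countBy-positive (lookup S′) (∈-allFin y) (trans (lookup-map y not S) (cong not y∉S))) degrees cut′
  take-smaller-side : Dec (size S ≤ size S′) → ∃[ m ] ((k ⊔ 2 ≤ m) × (m ≤ n / 2) × (adj G ⪯ Kkm n m k))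
  take-smaller-side (yes s≤s′) =
    from-smaller-side G S k≥1 cut k<s (subst (size S ≤_) (proj₁ (complement-sizes S)) s≤s′)
  take-smaller-side (no s≰s′) =
    from-smaller-side G S′ k≥1 cut′ k<s′ (subst (size S′ ≤_) (sym (proj₂ (complement-sizes S))) (<⇒≤ (≰⇒> s≰s′)))
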